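{- Suppose $w\in S_n$ avoids $3412$ and is not contained in any maximal parabolic subgroup $S_j\times S_{n-j}$ ($1\le j\le n-1$) of $S_n$. Order the bounding boxes of $\Gamma_{[e,w]}$ by the row of their northwest corner. If $\Gamma_{[e,w]}$ has more than one bounding box, then they alternate between blue and red, and no bounding box is purple.
   Context: $S_n$ in one-line notation ($w_i=w(i)$), $e$ the identity, Bruhat order. $S_j\times S_{n-j}$ denotes the permutations mapping $[j]$ to itself. $\Gamma_{[e,w]}:=\{(i,u_i): u\le w,\ i\in[n]\}\subseteq[n]^2$ with $(i,j)$ = row $i$, column $j$, rows numbered top to bottom. For $i\in[n]$, $B_{i,w_i}$ is the square region with corners $(i,i),(i,w_i),(w_i,i),(w_i,w_i)$. It is a bounding box of $\Gamma_{[e,w]}$ if it is not properly contained in any $B_{j,w_j}$; then $(i,w_i)$ is a spanning corner. A bounding box $B_{i,w_i}$ is red if $i>w_i$, green if $i=w_i$, blue if $i<w_i$; if $w^{ -1}(i)=w_i$ with $i\ne w_i$, so that $B_{i,w_i}=B_{w_i,i}$ arises from both a red and a blue spanning corner, the box is both red and blue and is called purple. -}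

module Defs where

open import Data.Nat using (ℕ; _≤_; _<_; _⊓_; _⊔_)
open import Data.Fin using (Fin; toℕ)
open import Data.Fin.Permutation using (Permutation′; _⟨$⟩ʳ_)
open import Data.Product using (_×_; Σ; ∃-syntax)
open import Data.Sum using (_⊎_)
open import Relation.Binary.PropositionalEquality using (_≡_)
open import Relation.Nullary using (¬_)

-- Positions are 0-indexed: position i : Fin n stands for i+1 ∈ [n].
-- w_i is  val w i  (as a natural number, 0-indexed).
val : {n : ℕ} → Permutation′ n → Fin n → ℕ
val w i = toℕ (w ⟨$⟩ʳ i)

Avoids3412 : {n : ℕ} → Permutation′ n → Set
Avoids3412 {n} w = ¬ (Σ (Fin n) λ a → Σ (Fin n) λ b → Σ (Fin n) λ c → Σ (Fin n) λ d →
  (toℕ a < toℕ b) × (toℕ b < toℕ c) × (toℕ c < toℕ d) ×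
  (val w c < val w d) × (val w d < val w a) × (val w a < val w b))

-- w ∈ S_j × S_{n-j}: w maps [j] = {positions with 0-index < j} to itself.
InParabolic : {n : ℕ} → Permutation′ n → ℕ → Set
InParabolic {n} w j = (i : Fin n) → toℕ i < j → val w i < j

NotInMaxParabolic : {n : ℕ} → Permutation′ n → Set
NotInMaxParabolic {n} w = (j : ℕ) → 1 ≤ j → j < n → ¬ InParabolic w j

-- The box B_{i,w_i} is the square [lo i, hi i] × [lo i, hi i].
lo : {n : ℕ} → Permutation′ n → Fin n → ℕ
lo w i = toℕ i ⊓ val w i

hi : {n : ℕ} → Permutation′ n → Fin n → ℕ
hi w i = toℕ i ⊔ val w i

BoxSub : {n : ℕ} → Permutation′ n → Fin n → Fin n → Set
BoxSub w i j = (lo w j ≤ lo w i) × (hi w i ≤ hi w j)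

SameBox : {n : ℕ} → Permutation′ n → Fin n → Fin n → Set
SameBox w i j = (lo w i ≡ lo w j) × (hi w i ≡ hi w j)

BoxProperSub : {n : ℕ} → Permutation′ n → Fin n → Fin n → Set
BoxProperSub w i j = BoxSub w i j × ¬ SameBox w i j

-- (i, w_i) is a spanning corner, i.e. B_{i,w_i} is a bounding box.
SpanningCorner : {n : ℕ} → Permutation′ n → Fin n → Set
SpanningCorner {n} w i = (j : Fin n) → ¬ BoxProperSub w i j

RedCorner : {n : ℕ} → Permutation′ n → Fin n → Set
RedCorner w i = val w i < toℕ i

BlueCorner : {n : ℕ} → Permutation′ n → Fin n → Set
BlueCorner w i = toℕ i < val w i

GreenCorner : {n : ℕ} → Permutation′ n → Fin n → Set
GreenCorner w i = val w i ≡ toℕ i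

-- B_{i,w_i} is purple: w^{-1}(i) = w_i with i ≠ w_i, i.e. w(w_i) = i.
Purple : {n : ℕ} → Permutation′ n → Fin n → Set
Purple w i = (w ⟨$⟩ʳ (w ⟨$⟩ʳ i) ≡ i) × ¬ (val w i ≡ toℕ i)

MoreThanOneBox : {n : ℕ} → Permutation′ n → Set
MoreThanOneBox {n} w = Σ (Fin n) λ i → Σ (Fin n) λ j →
  SpanningCorner w i × SpanningCorner w j × ¬ SameBox w i j

-- B_{j,w_j} is the bounding box immediately after B_{i,w_i} when ordered by
-- the row lo of the northwest corner (lo, lo).
NextBox : {n : ℕ} → Permutation′ n → Fin n → Fin n → Set
NextBox {n} w i j = SpanningCorner w i × SpanningCorner w j × (lo w i < lo w j) ×
  ((k : Fin n) → SpanningCorner w k → ¬ ((lo w i < lo w k) × (lo w k < lo w j)))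

OppositeColours : {n : ℕ} → Permutation′ n → Fin n → Fin n → Set
OppositeColours w i j = (BlueCorner w i × RedCorner w j) ⊎ (RedCorner w i × BlueCorner w j)

-- Every box B_{i,w_i} is the interval [lo i, hi i] on the diagonal, and the
-- bounding boxes are the maximal ones.  The proof rests on three facts.
--  * Counting: a permutation mapping {0..m-1} into itself maps it onto itself;
--    hence "w lies in no maximal parabolic subgroup" means that for every
--    proper cut 1 ≤ j < n some position left of j is sent to j or beyond
--    (`crossing`), and the same holds for w⁻¹.  Avoiding 3412 is also
--    inherited by w⁻¹.
--  * A 3412-avoiding permutation has no "sealed pair" (`no-sealed-pair`):
--    positions B < D with π(B) < π(D) ≤ B such that nothing left of π(D) is
--    sent to the right of B.
--  * Geometry of maximal intervals: a box starting left of a bounding box ends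
--    before it (`escape-left`, `escape-right`), every box lies in a bounding
--    box, and consecutive bounding boxes overlap with no box reaching across
--    the gap between their starts.
-- A green or purple bounding box is refuted by a crossing of its left or right
-- edge (one of them is a proper cut since there are two bounding boxes); two
-- consecutive red boxes form a sealed pair of w, two blue ones of w⁻¹.

module Submission where

open import Defs
open import Data.Nat using (ℕ; suc; _≤_; _<_; z≤n; s≤s; _+_; _∸_)
open import Data.Nat.Properties
open import Data.Nat.Induction using (<-wellFounded)
open import Data.Fin using (Fin; Fin′; toℕ; fromℕ<; inject; inject≤; punchOut)
open import Data.Fin.Properties
  using (toℕ-injective; toℕ-fromℕ<; toℕ<n; toℕ-inject; toℕ-inject≤; punchOut-injective;
         injective⇒≤; any?; all?; ¬∀⟶∃¬-smallest)
open import Data.Fin.Permutation using (Permutation′; _⟨$⟩ʳ_; _⟨$⟩ˡ_; flip; inverseˡ; inverseʳ)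
open import Data.Product using (∃-syntax; _×_; _,_; proj₁; proj₂)
open import Data.Sum using (_⊎_; inj₁; inj₂)
open import Data.Empty using (⊥; ⊥-elim)
open import Induction.WellFounded using (Acc; acc)
open import Relation.Binary.Definitions using (tri<; tri≈; tri>)
open import Relation.Binary.PropositionalEquality
  using (_≡_; _≢_; refl; sym; trans; cong; subst; subst₂; module ≡-Reasoning)
open import Relation.Nullary using (¬_; Dec; yes; no)
open import Relation.Nullary.Decidable using (_×-dec_; _→-dec_; ¬?; decidable-stable)

SealedPair : {n : ℕ} → Permutation′ n → Fin n → Fin n → Set
SealedPair π B D = (toℕ B < toℕ D) × (val π B < val π D) × (val π D ≤ toℕ B) ×
                   (∀ x → toℕ x < val π D → val π x ≤ toℕ B)

module _ {n : ℕ} (π : Permutation′ n) where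

  val-injective : ∀ {x y} → val π x ≡ val π y → x ≡ y
  val-injective {x} {y} eq = begin
    x                  ≡⟨ sym (inverseˡ π) ⟩
    π ⟨$⟩ˡ (π ⟨$⟩ʳ x)  ≡⟨ cong (π ⟨$⟩ˡ_) (toℕ-injective eq) ⟩
    π ⟨$⟩ˡ (π ⟨$⟩ʳ y)  ≡⟨ inverseˡ π ⟩
    y                  ∎
    where open ≡-Reasoning

  val-after-inverse : ∀ v → val π (flip π ⟨$⟩ʳ v) ≡ toℕ v
  val-after-inverse v = cong toℕ (inverseʳ π)

  inverse-after-val : ∀ x → val (flip π) (π ⟨$⟩ʳ x) ≡ toℕ x
  inverse-after-val x = cong toℕ (inverseˡ π)

  prefix-pigeonhole : ∀ {m e} → m ≤ n → InParabolic π m → e < m →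
                      ¬ (∀ y → toℕ y < m → val π y ≢ e)
  prefix-pigeonhole {suc m} {e} m≤n closed e<m misses = 1+n≰n (injective⇒≤ squeeze-injective)
    where
    position : Fin (suc m) → Fin n
    position y = inject≤ y m≤n
    position-below : ∀ y → toℕ (position y) < suc m
    position-below y = subst (_< suc m) (sym (toℕ-inject≤ y m≤n)) (toℕ<n y)
    image : Fin (suc m) → Fin (suc m)
    image y = fromℕ< (closed (position y) (position-below y))
    missed : ∀ y → fromℕ< e<m ≢ image y
    missed y eq = misses (position y) (position-below y) (begin
      val π (position y)  ≡⟨ sym (toℕ-fromℕ< _) ⟩
      toℕ (image y)       ≡⟨ cong toℕ (sym eq) ⟩
      toℕ (fromℕ< e<m)    ≡⟨ toℕ-fromℕ< e<m ⟩
      e                   ∎)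
      where open ≡-Reasoning
    -- removing the missed value leaves an injection of m+1 points into m
    squeeze : Fin (suc m) → Fin m
    squeeze y = punchOut (missed y)
    squeeze-injective : ∀ {x y} → squeeze x ≡ squeeze y → x ≡ y
    squeeze-injective {x} {y} eq = toℕ-injective (begin
      toℕ x             ≡⟨ sym (toℕ-inject≤ x m≤n) ⟩
      toℕ (position x)  ≡⟨ cong toℕ (val-injective same-value) ⟩
      toℕ (position y)  ≡⟨ toℕ-inject≤ y m≤n ⟩
      toℕ y             ∎)
      where
      open ≡-Reasoning
      same-value : val π (position x) ≡ val π (position y)
      same-value = trans (sym (toℕ-fromℕ< _))
        (trans (cong toℕ (punchOut-injective (missed x) (missed y) eq)) (toℕ-fromℕ< _))

  parabolic-onto : ∀ {m e} → m ≤ n → InParabolic π m → e < m →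
                   ∃[ y ] (toℕ y < m × val π y ≡ e)
  parabolic-onto {m} {e} m≤n closed e<m
    with any? (λ y → (toℕ y <? m) ×-dec (val π y ≟ e))
  ... | yes found = found
  ... | no none = ⊥-elim (prefix-pigeonhole m≤n closed e<m (λ y y<m eq → none (y , y<m , eq)))

  inParabolic-inverse : ∀ {m} → m ≤ n → InParabolic π m → InParabolic (flip π) m
  inParabolic-inverse m≤n closed v v<m with parabolic-onto m≤n closed v<m
  ... | y , y<m , πy≡v = subst (λ z → toℕ z < _) (val-injective same-value) y<m
    where
    same-value : val π y ≡ val π (flip π ⟨$⟩ʳ v)
    same-value = trans πy≡v (sym (val-after-inverse v))

  crossing : NotInMaxParabolic π → ∀ {j} → 1 ≤ j → j < n →
             ∃[ k ] (toℕ k < j × j ≤ val π k)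
  crossing nmp {j} 1≤j j<n with any? (λ k → (toℕ k <? j) ×-dec (j ≤? val π k))
  ... | yes found = found
  ... | no none = ⊥-elim (nmp j 1≤j j<n (λ k k<j → ≰⇒> (λ j≤πk → none (k , k<j , j≤πk))))

  -- 3412 is an involution, so pattern avoidance passes to the inverse.
  avoids3412-inverse : Avoids3412 π → Avoids3412 (flip π)
  avoids3412-inverse av (a , b , c , d , a<b , b<c , c<d , σc<σd , σd<σa , σa<σb) =
    av (σ c , σ d , σ a , σ b , σc<σd , σd<σa , σa<σb ,
        on-values a<b , on-values b<c , on-values c<d)
    where
    σ : Fin n → Fin n
    σ v = flip π ⟨$⟩ʳ v
    on-values : ∀ {u v} → toℕ u < toℕ v → val π (σ u) < val π (σ v)
    on-values {u} {v} = subst₂ _<_ (sym (val-after-inverse u)) (sym (val-after-inverse v))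

  -- Let x be the
  -- leftmost position ≤ B sent beyond B.  If there is none, {0..B} is mapped
  -- into itself but misses π(D).  Otherwise π(D) ≤ x < B, avoiding 3412 at
  -- (y, x, B, D) sends every y < x below π(D), so {0..x-1} is mapped into
  -- itself but misses π(B).
  no-sealed-pair : Avoids3412 π → ∀ {B D} → ¬ SealedPair π B D
  no-sealed-pair av {B} {D} (B<D , πB<πD , πD≤B , shielded) = by-cases (all? stays?)
    where
    Stays : Fin n → Set
    Stays y = toℕ y ≤ toℕ B → val π y ≤ toℕ B
    stays? : ∀ y → Dec (Stays y)
    stays? y = (toℕ y ≤? toℕ B) →-dec (val π y ≤? toℕ B)

    block-stays : (∀ y → Stays y) → ⊥
    block-stays all-stay = πD-not-hit
      (parabolic-onto (toℕ<n B) (λ y y<1+B → s≤s (all-stay y (≤-pred y<1+B))) (s≤s πD≤B))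
      where
      πD-not-hit : ∃[ y ] (toℕ y < suc (toℕ B) × val π y ≡ val π D) → ⊥
      πD-not-hit (y , y≤B , πy≡πD) =
        <⇒≱ B<D (≤-pred (subst (λ z → toℕ z < suc (toℕ B)) (val-injective πy≡πD) y≤B))

    first-escape : ∀ x → toℕ x ≤ toℕ B → toℕ B < val π x →
                   (∀ y → toℕ y < toℕ x → val π y ≤ toℕ B) → ⊥
    first-escape x x≤B B<πx earlier-stay =
      πB-not-hit (parabolic-onto (<⇒≤ (toℕ<n x)) earlier-below πB<x)
      where
      πD≤x : val π D ≤ toℕ x
      πD≤x = ≮⇒≥ (λ x<πD → <⇒≱ B<πx (shielded x x<πD))
      πB<x : val π B < toℕ x
      πB<x = <-≤-trans πB<πD πD≤x
      x<B : toℕ x < toℕ B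
      x<B = ≤∧≢⇒< x≤B (λ x≡B → <⇒≱ (<-≤-trans πB<πD πD≤B)
              (<⇒≤ (subst (λ z → toℕ B < val π z) (toℕ-injective x≡B) B<πx)))
      -- avoiding 3412 at (y, x, B, D) keeps every earlier value below π(D)
      earlier-below-πD : ∀ y → toℕ y < toℕ x → val π y < val π D
      earlier-below-πD y y<x with <-cmp (val π y) (val π D)
      ... | tri< below _ _ = below
      ... | tri≈ _ πy≡πD _ =
        ⊥-elim (<⇒≢ (<-trans (<-trans y<x x<B) B<D) (cong toℕ (val-injective πy≡πD)))
      ... | tri> _ _ above = ⊥-elim (av (y , x , B , D , y<x , x<B , B<D , πB<πD , above ,
                                         ≤-<-trans (earlier-stay y y<x) B<πx))
      earlier-below : InParabolic π (toℕ x)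
      earlier-below y y<x = <-≤-trans (earlier-below-πD y y<x) πD≤x
      πB-not-hit : ∃[ y ] (toℕ y < toℕ x × val π y ≡ val π B) → ⊥
      πB-not-hit (y , y<x , πy≡πB) =
        <⇒≱ x<B (<⇒≤ (subst (λ z → toℕ z < toℕ x) (val-injective πy≡πB) y<x))

    leftmost-escape : ∃[ x ] (¬ Stays x × ((j : Fin′ x) → Stays (inject j))) → ⊥
    leftmost-escape (x , x-escapes , earlier) with toℕ x ≤? toℕ B
    ... | no x≰B = x-escapes (λ x≤B → ⊥-elim (x≰B x≤B))
    ... | yes x≤B = first-escape x x≤B (≰⇒> (λ πx≤B → x-escapes (λ _ → πx≤B))) earlier-stay
      where
      earlier-stay : ∀ y → toℕ y < toℕ x → val π y ≤ toℕ B
      earlier-stay y y<x = subst Stays (toℕ-injective (trans (toℕ-inject j) (toℕ-fromℕ< y<x)))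
                             (earlier j) (<⇒≤ (<-≤-trans y<x x≤B))
        where j = fromℕ< y<x

    by-cases : Dec (∀ y → Stays y) → ⊥
    by-cases (yes all-stay) = block-stays all-stay
    by-cases (no ¬all-stay) = leftmost-escape (¬∀⟶∃¬-smallest n Stays stays? ¬all-stay)

notInMaxParabolic-inverse : {n : ℕ} (π : Permutation′ n) →
                            NotInMaxParabolic π → NotInMaxParabolic (flip π)
notInMaxParabolic-inverse π nmp j 1≤j j<n inverse-closed =
  nmp j 1≤j j<n (inParabolic-inverse (flip π) (<⇒≤ j<n) inverse-closed)

module _ {n : ℕ} (w : Permutation′ n) where

  lo≤pos : ∀ x → lo w x ≤ toℕ x
  lo≤pos x = m⊓n≤m (toℕ x) (val w x)

  lo≤val : ∀ x → lo w x ≤ val w x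
  lo≤val x = m⊓n≤n (toℕ x) (val w x)

  pos≤hi : ∀ x → toℕ x ≤ hi w x
  pos≤hi x = m≤m⊔n (toℕ x) (val w x)

  val≤hi : ∀ x → val w x ≤ hi w x
  val≤hi x = m≤n⊔m (toℕ x) (val w x)

  hi<n : ∀ x → hi w x < n
  hi<n x = ⊔-lub (toℕ<n x) (toℕ<n (w ⟨$⟩ʳ x))

  blue-lo : ∀ {x} → BlueCorner w x → lo w x ≡ toℕ x
  blue-lo blue = m≤n⇒m⊓n≡m (<⇒≤ blue)

  blue-hi : ∀ {x} → BlueCorner w x → hi w x ≡ val w x
  blue-hi blue = m≤n⇒m⊔n≡n (<⇒≤ blue)

  red-lo : ∀ {x} → RedCorner w x → lo w x ≡ val w x
  red-lo red = m≥n⇒m⊓n≡n (<⇒≤ red)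

  red-hi : ∀ {x} → RedCorner w x → hi w x ≡ toℕ x
  red-hi red = m≥n⇒m⊔n≡m (<⇒≤ red)

  green-thin : ∀ {x} → GreenCorner w x → hi w x ≡ lo w x
  green-thin green = trans (m≥n⇒m⊔n≡m (≤-reflexive green)) (sym (m≤n⇒m⊓n≡m (≤-reflexive (sym green))))

  BoxSub-trans : ∀ {x y z} → BoxSub w x y → BoxSub w y z → BoxSub w x z
  BoxSub-trans (ly≤lx , hx≤hy) (lz≤ly , hy≤hz) = ≤-trans lz≤ly ly≤lx , ≤-trans hx≤hy hy≤hz

  sameBox? : ∀ x y → Dec (SameBox w x y)
  sameBox? x y = (lo w x ≟ lo w y) ×-dec (hi w x ≟ hi w y)

  boxProperSub? : ∀ x y → Dec (BoxProperSub w x y)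
  boxProperSub? x y = ((lo w y ≤? lo w x) ×-dec (hi w x ≤? hi w y)) ×-dec ¬? (sameBox? x y)

  spanning-maximal : ∀ {i x} → SpanningCorner w i → BoxSub w i x → SameBox w i x
  spanning-maximal {i} {x} si i⊆x = decidable-stable (sameBox? i x) (λ differ → si x (i⊆x , differ))

  escape-left : ∀ {i x} → SpanningCorner w i → lo w x < lo w i → hi w x < hi w i
  escape-left si lx<li = ≰⇒> (λ hi≤hx →
    <⇒≢ lx<li (sym (proj₁ (spanning-maximal si (<⇒≤ lx<li , hi≤hx)))))

  escape-right : ∀ {i x} → SpanningCorner w i → hi w i < hi w x → lo w i < lo w x
  escape-right si hi<hx = ≰⇒> (λ lx≤li →
    <⇒≢ hi<hx (proj₂ (spanning-maximal si (lx≤li , <⇒≤ hi<hx))))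

  slack : Fin n → ℕ
  slack x = lo w x + (n ∸ hi w x)

  slack-decreases : ∀ {x y} → BoxProperSub w x y → slack y < slack x
  slack-decreases {x} {y} ((ly≤lx , hx≤hy) , differ) with lo w x ≟ lo w y
  ... | no lx≢ly = +-mono-<-≤ (≤∧≢⇒< ly≤lx (λ ly≡lx → lx≢ly (sym ly≡lx))) (∸-monoʳ-≤ n hx≤hy)
  ... | yes lx≡ly = subst (λ l → slack y < l + (n ∸ hi w x)) (sym lx≡ly)
        (+-monoʳ-< (lo w y) (∸-monoʳ-< (≤∧≢⇒< hx≤hy (λ hx≡hy → differ (lx≡ly , hx≡hy))) (<⇒≤ (hi<n y))))

  enclosing-bounding-box : ∀ x → ∃[ K ] (SpanningCorner w K × BoxSub w x K)
  enclosing-bounding-box x = climb x (<-wellFounded (slack x))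
    where
    climb : ∀ x → Acc _<_ (slack x) → ∃[ K ] (SpanningCorner w K × BoxSub w x K)
    climb x (acc smaller) with any? (boxProperSub? x)
    ... | no maximal = x , (λ y x⊊y → maximal (y , x⊊y)) , (≤-refl , ≤-refl)
    ... | yes (y , x⊊y) with climb y (smaller (slack-decreases x⊊y))
    ...   | K , spanningK , y⊆K = K , spanningK , BoxSub-trans (proj₁ x⊊y) y⊆K

  bounding-box-not-full : MoreThanOneBox w → ∀ {i} → SpanningCorner w i →
                          0 < lo w i ⊎ suc (hi w i) < n
  bounding-box-not-full (p , q , sp , sq , p≢q) {i} si with lo w i ≟ 0 | suc (hi w i) ≟ n
  ... | no lo≢0 | _ = inj₁ (n≢0⇒n>0 lo≢0)
  ... | yes _ | no hi≢n-1 = inj₂ (≤∧≢⇒< (hi<n i) hi≢n-1)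
  ... | yes lo≡0 | yes hi≡n-1 =
    ⊥-elim (p≢q (same-as-i (spanning-maximal sp (inside p)) (spanning-maximal sq (inside q))))
    where
    inside : ∀ x → BoxSub w x i
    inside x = subst (_≤ lo w x) (sym lo≡0) z≤n
             , ≤-pred (subst (hi w x <_) (sym hi≡n-1) (hi<n x))
    same-as-i : SameBox w p i → SameBox w q i → SameBox w p q
    same-as-i (lp≡li , hp≡hi) (lq≡li , hq≡hi) = trans lp≡li (sym lq≡li) , trans hp≡hi (sym hq≡hi)

  -- No box starts before the start of the next bounding box j and ends after
  -- the end of the bounding box i: it would lie in a bounding box in between.
  no-box-across-gap : ∀ {i j x} → NextBox w i j → lo w x < lo w j → hi w i < hi w x → ⊥
  no-box-across-gap {i} {j} {x} (si , _ , _ , nothing-between) lx<lj hi<hx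
    with enclosing-bounding-box x
  ... | K , sK , (lK≤lx , hx≤hK) with lo w K ≤? lo w i
  ...   | yes lK≤li = <⇒≱ (escape-right si (<-≤-trans hi<hx hx≤hK)) lK≤li
  ...   | no lK≰li = nothing-between K sK (≰⇒> lK≰li , ≤-<-trans lK≤lx lx<lj)

  next-ends-later : ∀ {i j} → NextBox w i j → hi w i < hi w j
  next-ends-later (_ , sj , li<lj , _) = escape-left sj li<lj

  -- ... and starts before the earlier one ends, since w crosses the cut after hi i.
  next-overlaps : NotInMaxParabolic w → ∀ {i j} → NextBox w i j → lo w j ≤ hi w i
  next-overlaps nmp {i} {j} next with lo w j ≤? hi w i
  ... | yes overlapping = overlapping
  ... | no gap with crossing w nmp (s≤s z≤n) (<-≤-trans (s≤s (next-ends-later next)) (hi<n j))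
  ...   | k , k≤hi , hi<wk = ⊥-elim (no-box-across-gap next
          (≤-<-trans (lo≤pos k) (<-≤-trans k≤hi (≰⇒> gap))) (<-≤-trans hi<wk (val≤hi k)))

  -- No bounding box [i, i] is green: a position left of i sent to i or beyond,
  -- or a position ≤ i sent beyond i, would give a box strictly containing it.
  not-green : NotInMaxParabolic w → MoreThanOneBox w → ∀ {i} → SpanningCorner w i →
              ¬ GreenCorner w i
  not-green nmp more {i} si green with bounding-box-not-full more si
  ... | inj₁ 0<lo with crossing w nmp 0<lo (≤-<-trans (lo≤pos i) (toℕ<n i))
  ...   | k , k<lo , lo≤wk = <⇒≱ (escape-left si (≤-<-trans (lo≤pos k) k<lo))
          (≤-trans (≤-reflexive (green-thin green)) (≤-trans lo≤wk (val≤hi k)))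
  not-green nmp more {i} si green | inj₂ hi<n-1 with crossing w nmp (s≤s z≤n) hi<n-1
  ...   | k , k≤hi , hi<wk = <⇒≱ (escape-right si (<-≤-trans hi<wk (val≤hi k)))
          (≤-trans (lo≤pos k) (≤-trans (≤-pred k≤hi) (≤-reflexive (green-thin green))))

  -- A crossing of its left edge, by w at k and by w⁻¹ at t, gives the pattern
  -- 3412 at k < L < t < U; a crossing of its right edge gives it at L < k < U < t.
  no-swapped-bounding-box : Avoids3412 w → NotInMaxParabolic w → MoreThanOneBox w →
    ∀ {i L U} → SpanningCorner w i → lo w i ≡ toℕ L → hi w i ≡ toℕ U → toℕ L < toℕ U →
    val w L ≡ toℕ U → val w U ≡ toℕ L → ⊥
  no-swapped-bounding-box av nmp more {i} {L} {U} si loL hiU L<U wL wU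
    with bounding-box-not-full more si
  ... | inj₁ 0<lo = left-crossing (subst (0 <_) loL 0<lo)
    where
    left-crossing : 0 < toℕ L → ⊥
    left-crossing 0<L
      with crossing w nmp 0<L (<-trans L<U (toℕ<n U))
         | crossing (flip w) (notInMaxParabolic-inverse w nmp) 0<L (<-trans L<U (toℕ<n U))
    ... | k , k<L , L≤wk | v , v<L , L≤t =
      av (k , L , t , U , k<L , L<t , t<U , wt<wU , wU<wk , wk<wL)
      where
      t = flip w ⟨$⟩ʳ v
      wt≡v : val w t ≡ toℕ v
      wt≡v = val-after-inverse w v
      ends-before-U : ∀ x → lo w x < toℕ L → hi w x < toℕ U
      ends-before-U x lx<L = subst (hi w x <_) hiU (escape-left si (subst (lo w x <_) (sym loL) lx<L))
      L<t : toℕ L < toℕ t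
      L<t = ≤∧≢⇒< L≤t (λ L≡t → <⇒≢ (<-trans v<L L<U)
              (trans (sym wt≡v) (trans (cong (val w) (toℕ-injective (sym L≡t))) wL)))
      t<U : toℕ t < toℕ U
      t<U = ≤-<-trans (pos≤hi t) (ends-before-U t (≤-<-trans (lo≤val t) (subst (_< toℕ L) (sym wt≡v) v<L)))
      wt<wU : val w t < val w U
      wt<wU = subst₂ _<_ (sym wt≡v) (sym wU) v<L
      wU<wk : val w U < val w k
      wU<wk = ≤∧≢⇒< (subst (_≤ val w k) (sym wU) L≤wk)
                (λ wU≡wk → <⇒≢ (<-trans k<L L<U) (cong toℕ (val-injective w (sym wU≡wk))))
      wk<wL : val w k < val w L
      wk<wL = subst (val w k <_) (sym wL) (≤-<-trans (val≤hi k) (ends-before-U k (≤-<-trans (lo≤pos k) k<L)))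
  ... | inj₂ hi<n-1 = right-crossing (subst (λ h → suc h < n) hiU hi<n-1)
    where
    right-crossing : suc (toℕ U) < n → ⊥
    right-crossing U<n-1
      with crossing w nmp (s≤s z≤n) U<n-1
         | crossing (flip w) (notInMaxParabolic-inverse w nmp) (s≤s z≤n) U<n-1
    ... | k , k≤U , U<wk | v , v≤U , U<t =
      av (L , k , U , t , L<k , k<U , U<t , wU<wt , wt<wL , wL<wk)
      where
      t = flip w ⟨$⟩ʳ v
      wt≡v : val w t ≡ toℕ v
      wt≡v = val-after-inverse w v
      starts-after-L : ∀ x → toℕ U < hi w x → toℕ L < lo w x
      starts-after-L x U<hx = subst (_< lo w x) loL (escape-right si (subst (_< hi w x) (sym hiU) U<hx))
      L<k : toℕ L < toℕ k
      L<k = <-≤-trans (starts-after-L k (<-≤-trans U<wk (val≤hi k))) (lo≤pos k)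
      k<U : toℕ k < toℕ U
      k<U = ≤∧≢⇒< (≤-pred k≤U) (λ k≡U → <⇒≢ (<-trans L<U U<wk)
              (trans (sym wU) (cong (val w) (toℕ-injective (sym k≡U)))))
      wU<wt : val w U < val w t
      wU<wt = subst₂ _<_ (sym wU) (sym wt≡v)
                (<-≤-trans (starts-after-L t (<-≤-trans U<t (pos≤hi t))) (subst (lo w t ≤_) wt≡v (lo≤val t)))
      wt<wL : val w t < val w L
      wt<wL = subst₂ _<_ (sym wt≡v) (sym wL) (≤∧≢⇒< (≤-pred v≤U) (λ v≡U → <⇒≢ (<-trans L<U U<t)
                (cong toℕ (val-injective w (trans wL (trans (sym v≡U) (sym wt≡v)))))))
      wL<wk : val w L < val w k
      wL<wk = subst (_< val w k) (sym wL) U<wk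

  -- Hence no bounding box is purple: its corners i and w(i) would be swapped.
  not-purple : Avoids3412 w → NotInMaxParabolic w → MoreThanOneBox w →
               ∀ {i} → SpanningCorner w i → ¬ Purple w i
  not-purple av nmp more {i} si (w²i≡i , not-fixed) with <-cmp (toℕ i) (val w i)
  ... | tri< blue _ _ = no-swapped-bounding-box av nmp more si
                          (blue-lo blue) (blue-hi blue) blue refl (cong toℕ w²i≡i)
  ... | tri≈ _ fixed _ = not-fixed (sym fixed)
  ... | tri> _ _ red = no-swapped-bounding-box av nmp more si
                         (red-lo red) (red-hi red) red (cong toℕ w²i≡i) refl

  red-or-blue : NotInMaxParabolic w → MoreThanOneBox w → ∀ {i} → SpanningCorner w i →
                RedCorner w i ⊎ BlueCorner w i
  red-or-blue nmp more si with <-cmp (val w _) (toℕ _)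
  ... | tri< red _ _ = inj₁ red
  ... | tri≈ _ green _ = ⊥-elim (not-green nmp more si green)
  ... | tri> _ _ blue = inj₂ blue

  red-pair-sealed : NotInMaxParabolic w → ∀ {i j} → NextBox w i j →
                    RedCorner w i → RedCorner w j → SealedPair w i j
  red-pair-sealed nmp {i} {j} next@(_ , _ , li<lj , _) ri rj =
    subst₂ _<_ (red-hi ri) (red-hi rj) (next-ends-later next) ,
    subst₂ _<_ (red-lo ri) (red-lo rj) li<lj ,
    subst₂ _≤_ (red-lo rj) (red-hi ri) (next-overlaps nmp next) ,
    shielded
    where
    shielded : ∀ x → toℕ x < val w j → val w x ≤ toℕ i
    shielded x x<wj = ≮⇒≥ (λ i<wx → no-box-across-gap next
      (≤-<-trans (lo≤pos x) (subst (toℕ x <_) (sym (red-lo rj)) x<wj))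
      (<-≤-trans (subst (_< val w x) (sym (red-hi ri)) i<wx) (val≤hi x)))

  blue-pair-sealed : NotInMaxParabolic w → ∀ {i j} → NextBox w i j →
                     BlueCorner w i → BlueCorner w j → SealedPair (flip w) (w ⟨$⟩ʳ i) (w ⟨$⟩ʳ j)
  blue-pair-sealed nmp {i} {j} next@(_ , _ , li<lj , _) bi bj =
    subst₂ _<_ (blue-hi bi) (blue-hi bj) (next-ends-later next) ,
    subst₂ _<_ (lo-as-inverse bi) (lo-as-inverse bj) li<lj ,
    subst₂ _≤_ (lo-as-inverse bj) (blue-hi bi) (next-overlaps nmp next) ,
    shielded
    where
    lo-as-inverse : ∀ {x} → BlueCorner w x → lo w x ≡ val (flip w) (w ⟨$⟩ʳ x)
    lo-as-inverse {x} bx = trans (blue-lo bx) (sym (inverse-after-val w x))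
    shielded : ∀ v → toℕ v < val (flip w) (w ⟨$⟩ʳ j) → val (flip w) v ≤ val w i
    shielded v v<j = ≮⇒≥ (λ wi<t → no-box-across-gap next
      (≤-<-trans (lo≤val t) (subst₂ _<_ (sym (val-after-inverse w v)) (sym (lo-as-inverse bj)) v<j))
      (<-≤-trans (subst (_< toℕ t) (sym (blue-hi bi)) wi<t) (pos≤hi t)))
      where t = flip w ⟨$⟩ʳ v

  consecutive-opposite : Avoids3412 w → NotInMaxParabolic w → MoreThanOneBox w →
                         ∀ {i j} → NextBox w i j → OppositeColours w i j
  consecutive-opposite av nmp more next@(si , sj , _ , _)
    with red-or-blue nmp more si | red-or-blue nmp more sj
  ... | inj₁ ri | inj₁ rj = ⊥-elim (no-sealed-pair w av (red-pair-sealed nmp next ri rj))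
  ... | inj₁ ri | inj₂ bj = inj₂ (ri , bj)
  ... | inj₂ bi | inj₁ rj = inj₁ (bi , rj)
  ... | inj₂ bi | inj₂ bj =
    ⊥-elim (no-sealed-pair (flip w) (avoids3412-inverse w av) (blue-pair-sealed nmp next bi bj))

proposition5p8 : (n : ℕ) (w : Permutation′ n) → Avoids3412 w → NotInMaxParabolic w →
    MoreThanOneBox w →
    ((i : Fin n) → SpanningCorner w i → (RedCorner w i ⊎ BlueCorner w i) × ¬ Purple w i) ×
    ((i j : Fin n) → NextBox w i j → OppositeColours w i j)
proposition5p8 n w av nmp more =
  (λ i si → red-or-blue w nmp more si , not-purple w av nmp more si) ,
  (λ i j next → consecutive-opposite w av nmp more next)
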